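{- Let $\mathcal{V}$ be a finite set and $\mathcal{F}$ a finite family of subsets of $\mathcal{V}$, and let $BM$, $\mathrm{left}$, $\mathrm{right}$ and $\mathrm{Max}$ be as in the context. Let $X,Y\in\mathcal{F}$ be such that $X\cap Y\neq\emptyset$, $\mathrm{Max}(X)\neq\emptyset$, and $|X|\le|Y|\le|\mathrm{Max}(X)|$. Let $r_Y$ be the row of $Y$ in $BM$. If $BM[r_Y,\mathrm{left}(X)]=0$, then $Y$ overlaps $X$. Otherwise (i.e. $BM[r_Y,\mathrm{left}(X)]=1$): (a) if $BM[r_Y,\mathrm{right}(X)]=0$, then $Y$ overlaps $X$; and (b) if $BM[r_Y,\mathrm{right}(X)]=1$, then $Y$ overlaps $\mathrm{Max}(X)$.
   Context: Two sets $A,B$ overlap if $A\cap B\neq\emptyset$, $A\setminus B\neq\emptyset$ and $B\setminus A\neq\emptyset$. $LF$ is the list of all sets of $\mathcal{F}$ sorted in decreasing order of size, ties broken in an arbitrary but fixed way. For $X\in\mathcal{F}$, $\mathrm{Max}(X)$ is the first set $Y$ in $LF$ order with $|Y|\ge|X|$ that overlaps $X$ ($\mathrm{Max}(X)=\emptyset$ if none exists). $BM$ is the boolean matrix whose rows correspond to the sets of $\mathcal{F}$ in $LF$ order (top to bottom), whose columns correspond to the elements of $\mathcal{V}$ arranged so that the columns, each read as a $0/1$ word from top row to bottom row with $0<1$, are in increasing lexicographic order from left to right, and with entry $1$ iff the column's element belongs to the row's set. $\mathrm{left}(X)$ (resp. $\mathrm{right}(X)$) is the index of the column containing the leftmost (resp.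 rightmost) $1$ in the row of $X$. -}

module Defs where

open import Data.Nat using (ℕ; _≤_)
open import Data.Bool using (Bool; true; false)
open import Data.Fin using (Fin) renaming (_≤_ to _≤ᶠ_; _<_ to _<ᶠ_)
open import Data.Fin.Subset using (Subset; _∈_; _∉_; ∣_∣)
open import Data.Fin.Permutation using (Permutation′; _⟨$⟩ʳ_)
open import Data.Vec using (Vec; []; _∷_; tabulate; lookup)
open import Data.Product using (_×_; ∃)
open import Relation.Nullary using (¬_)
open import Relation.Binary.PropositionalEquality using (_≡_)

-- V = Fin n; the family F has m members, given as the rows of BM
-- in LF order: F i is the set of row i (row 0 = top).

Overlaps : ∀ {n} → Subset n → Subset n → Set
Overlaps A B = (∃ λ x → x ∈ A × x ∈ B) × (∃ λ x → x ∈ A × x ∉ B) × (∃ λ x → x ∈ B × x ∉ A)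

SortedLF : ∀ {n m} → (Fin m → Subset n) → Set
SortedLF F = ∀ i j → i ≤ᶠ j → ∣ F j ∣ ≤ ∣ F i ∣

Distinct : ∀ {n m} → (Fin m → Subset n) → Set
Distinct F = ∀ i j → F i ≡ F j → i ≡ j

data LexLeq : ∀ {k} → Vec Bool k → Vec Bool k → Set where
  lex-nil : LexLeq [] []
  lex-lt  : ∀ {k} {xs ys : Vec Bool k} → LexLeq (false ∷ xs) (true ∷ ys)
  lex-eq  : ∀ {k} b {xs ys : Vec Bool k} → LexLeq xs ys → LexLeq (b ∷ xs) (b ∷ ys)

-- Column at position j of BM, where π maps column positions to elements of V;
-- read top to bottom.
column : ∀ {n m} → (Fin m → Subset n) → Permutation′ n → Fin n → Vec Bool m
column F π j = tabulate (λ i → lookup (F i) (π ⟨$⟩ʳ j))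

ColumnsSorted : ∀ {n m} → (Fin m → Subset n) → Permutation′ n → Set
ColumnsSorted F π = ∀ j j' → j ≤ᶠ j' → LexLeq (column F π j) (column F π j')

IsLeft : ∀ {n m} → (Fin m → Subset n) → Permutation′ n → Fin m → Fin n → Set
IsLeft F π iX l = (π ⟨$⟩ʳ l) ∈ F iX × (∀ j → j <ᶠ l → (π ⟨$⟩ʳ j) ∉ F iX)

IsRight : ∀ {n m} → (Fin m → Subset n) → Permutation′ n → Fin m → Fin n → Set
IsRight F π iX r = (π ⟨$⟩ʳ r) ∈ F iX × (∀ j → r <ᶠ j → (π ⟨$⟩ʳ j) ∉ F iX)

-- Max(X) is the row iM: the first row in LF order with |F iM| ≥ |X| that overlaps X.
-- (Having such an iM is exactly Max(X) ≠ ∅.)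
IsMax : ∀ {n m} → (Fin m → Subset n) → Fin m → Fin m → Set
IsMax F iX iM =
  (∣ F iX ∣ ≤ ∣ F iM ∣ × Overlaps (F iM) (F iX)) ×
  (∀ k → k <ᶠ iM → ¬ (∣ F iX ∣ ≤ ∣ F k ∣ × Overlaps (F k) (F iX)))

-- Rows above Max(X) are at least as large as X and do not overlap it, so
-- each of them contains X or misses it: the columns of the elements of X
-- agree on all rows above Max(X). Lexicographic sortedness then makes the
-- row of Max(X), restricted to the columns of X, a run of 0s followed by
-- a run of 1s. As Max(X) overlaps X, both runs are nonempty, so Max(X)
-- misses left(X) and contains right(X). A set Y with |Y| ≤ |Max(X)|
-- containing both columns therefore overlaps Max(X); in the other cases
-- Y misses a point of X, and |X| ≤ |Y| forces Y to overlap X.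
module Submission where

open import Defs
open import Data.Nat using (ℕ; _≤_; s≤s; z≤n)
open import Data.Nat.Properties using (<⇒≱; ≮⇒≥; ≤-trans; <⇒≤)
open import Data.Bool using (Bool; true)
open import Data.Fin using (Fin; zero; suc) renaming (_≤_ to _≤ᶠ_; _<_ to _<ᶠ_)
open import Data.Fin.Properties using (¬∀⟶∃¬)
open import Data.Fin.Subset using (Subset; _∈_; _∉_; _⊈_; ∣_∣; _∩_; Nonempty)
open import Data.Fin.Subset.Properties using (_∈?_; p⊂q⇒∣p∣<∣q∣; x∈p∩q⁻)
open import Data.Fin.Permutation using (Permutation′; _⟨$⟩ʳ_; _⟨$⟩ˡ_; inverseʳ)
open import Data.Vec using (Vec; lookup)
open import Data.Vec.Properties using (lookup∘tabulate; []=⇒lookup; lookup⇒[]=)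
open import Data.Bool.Properties using (⇔→≡)
open import Data.Product using (_×_; _,_; ∃; proj₁; proj₂)
open import Function using (_⇔_; mk⇔)
open import Function.Properties.Equivalence using () renaming (trans to ⇔-trans; sym to ⇔-sym)
open import Relation.Nullary using (yes; no; contradiction)
open import Relation.Nullary.Decidable using (_→-dec_)
open import Relation.Binary.PropositionalEquality using (_≡_; sym; trans; subst; module ≡-Reasoning)

⊈⇒∃∉ : ∀ {n} {p q : Subset n} → p ⊈ q → ∃ λ x → x ∈ p × x ∉ q
⊈⇒∃∉ {n} {p} {q} p⊈q
  with ¬∀⟶∃¬ n (λ x → x ∈ p → x ∈ q) (λ x → x ∈? p →-dec x ∈? q) (λ p⊆q → p⊈q (p⊆q _))
... | x , x∈p↛x∈q with x ∈? p
...   | yes x∈p = x , x∈p , λ x∈q → x∈p↛x∈q (λ _ → x∈q)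
...   | no  x∉p = contradiction (λ x∈p → contradiction x∈p x∉p) x∈p↛x∈q

x∈q∧x∉p∧∣q∣≤∣p∣⇒p⊈q : ∀ {n} {p q : Subset n} {x} →
                      x ∈ q → x ∉ p → ∣ q ∣ ≤ ∣ p ∣ → p ⊈ q
x∈q∧x∉p∧∣q∣≤∣p∣⇒p⊈q x∈q x∉p ∣q∣≤∣p∣ p⊆q = <⇒≱ (p⊂q⇒∣p∣<∣q∣ (p⊆q , _ , x∈q , x∉p)) ∣q∣≤∣p∣

Overlaps-sym : ∀ {n} {p q : Subset n} → Overlaps p q → Overlaps q p
Overlaps-sym ((x , x∈p , x∈q) , p∖q , q∖p) = (x , x∈q , x∈p) , q∖p , p∖q

meets∧misses∧∣q∣≤∣p∣⇒Overlaps : ∀ {n} {p q : Subset n} {x y} →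
  y ∈ p → y ∈ q → x ∈ q → x ∉ p → ∣ q ∣ ≤ ∣ p ∣ → Overlaps p q
meets∧misses∧∣q∣≤∣p∣⇒Overlaps y∈p y∈q x∈q x∉p ∣q∣≤∣p∣ =
  (_ , y∈p , y∈q) , ⊈⇒∃∉ (x∈q∧x∉p∧∣q∣≤∣p∣⇒p⊈q x∈q x∉p ∣q∣≤∣p∣) , (_ , x∈q , x∉p)

∈⇔lookup≡true : ∀ {n} {p : Subset n} {x} → x ∈ p ⇔ lookup p x ≡ true
∈⇔lookup≡true {x = x} = mk⇔ []=⇒lookup (lookup⇒[]= x _)

LexLeq⇒lookup-true-mono : ∀ {k} {u v : Vec Bool k} → LexLeq u v → (i : Fin k) →
  (∀ j → j <ᶠ i → lookup u j ≡ lookup v j) → lookup u i ≡ true → lookup v i ≡ true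
LexLeq⇒lookup-true-mono lex-lt zero _ ()
LexLeq⇒lookup-true-mono lex-lt (suc i) agree _ with agree zero (s≤s z≤n)
... | ()
LexLeq⇒lookup-true-mono (lex-eq _ _) zero _ uᵢ = uᵢ
LexLeq⇒lookup-true-mono (lex-eq _ u≤v) (suc i) agree =
  LexLeq⇒lookup-true-mono u≤v i (λ j j<i → agree (suc j) (s≤s j<i))

module _ {n m} {F : Fin m → Subset n} (π : Permutation′ n) (columns-sorted : ColumnsSorted F π) where

  lookup-column : ∀ j i → lookup (column F π j) i ≡ lookup (F i) (π ⟨$⟩ʳ j)
  lookup-column j = lookup∘tabulate (λ i → lookup (F i) (π ⟨$⟩ʳ j))

  column-agree : ∀ {j j'} k → (π ⟨$⟩ʳ j ∈ F k ⇔ π ⟨$⟩ʳ j' ∈ F k) →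
                 lookup (column F π j) k ≡ lookup (column F π j') k
  column-agree {j} {j'} k j∈⇔j'∈ = begin
    lookup (column F π j) k   ≡⟨ lookup-column j k ⟩
    lookup (F k) (π ⟨$⟩ʳ j)   ≡⟨ ⇔→≡ (⇔-trans (⇔-sym ∈⇔lookup≡true) (⇔-trans j∈⇔j'∈ ∈⇔lookup≡true)) ⟩
    lookup (F k) (π ⟨$⟩ʳ j')  ≡⟨ lookup-column j' k ⟨
    lookup (column F π j') k  ∎
    where open ≡-Reasoning

  ∈-mono-below-agreement : ∀ {j j'} i → j ≤ᶠ j' →
    (∀ k → k <ᶠ i → π ⟨$⟩ʳ j ∈ F k ⇔ π ⟨$⟩ʳ j' ∈ F k) →
    π ⟨$⟩ʳ j ∈ F i → π ⟨$⟩ʳ j' ∈ F i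
  ∈-mono-below-agreement {j} {j'} i j≤j' agree j∈Fi =
    lookup⇒[]= _ _ (trans (sym (lookup-column j' i))
      (LexLeq⇒lookup-true-mono (columns-sorted j j' j≤j') i
        (λ k k<i → column-agree k (agree k k<i))
        (trans (lookup-column j i) ([]=⇒lookup j∈Fi))))

module _ {n m} {F : Fin m → Subset n} (sorted : SortedLF F) {iX iM : Fin m} (isMax : IsMax F iX iM) where

  private
    X = F iX
    M = F iM

    ∣X∣≤∣M∣ : ∣ X ∣ ≤ ∣ M ∣
    ∣X∣≤∣M∣ = proj₁ (proj₁ isMax)

    M-overlaps-X : Overlaps M X
    M-overlaps-X = proj₂ (proj₁ isMax)

  above-Max-∈-uniform-on-X : ∀ k → k <ᶠ iM → ∀ {x y} → x ∈ X → y ∈ X → x ∈ F k → y ∈ F k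
  above-Max-∈-uniform-on-X k k<iM {y = y} x∈X y∈X x∈Fk with y ∈? F k
  ... | yes y∈Fk = y∈Fk
  ... | no  y∉Fk = contradiction
          (∣X∣≤∣Fk∣ , meets∧misses∧∣q∣≤∣p∣⇒Overlaps x∈Fk x∈X y∈X y∉Fk ∣X∣≤∣Fk∣)
          (proj₂ isMax k k<iM)
    where
    ∣X∣≤∣Fk∣ : ∣ X ∣ ≤ ∣ F k ∣
    ∣X∣≤∣Fk∣ = ≤-trans ∣X∣≤∣M∣ (sorted k iM (<⇒≤ k<iM))

  module _ (π : Permutation′ n) (columns-sorted : ColumnsSorted F π) where

    Max-∈-mono-on-X : ∀ {j j'} → j ≤ᶠ j' → π ⟨$⟩ʳ j ∈ X → π ⟨$⟩ʳ j' ∈ X →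
                      π ⟨$⟩ʳ j ∈ M → π ⟨$⟩ʳ j' ∈ M
    Max-∈-mono-on-X j≤j' j∈X j'∈X = ∈-mono-below-agreement π columns-sorted iM j≤j'
      (λ k k<iM → mk⇔ (above-Max-∈-uniform-on-X k k<iM j∈X j'∈X)
                      (above-Max-∈-uniform-on-X k k<iM j'∈X j∈X))

    ∈X⇒column∈X : ∀ {z} → z ∈ X → π ⟨$⟩ʳ (π ⟨$⟩ˡ z) ∈ X
    ∈X⇒column∈X = subst (_∈ X) (sym (inverseʳ π))

    left∉Max : ∀ l → IsLeft F π iX l → π ⟨$⟩ʳ l ∉ M
    left∉Max l (l∈X , before-l∉X) l∈M with M-overlaps-X
    ... | _ , _ , (z , z∈X , z∉M) = z∉M (subst (_∈ M) (inverseʳ π)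
            (Max-∈-mono-on-X l≤z l∈X (∈X⇒column∈X z∈X) l∈M))
      where
      l≤z : l ≤ᶠ π ⟨$⟩ˡ z
      l≤z = ≮⇒≥ (λ z<l → before-l∉X _ z<l (∈X⇒column∈X z∈X))

    right∈Max : ∀ r → IsRight F π iX r → π ⟨$⟩ʳ r ∈ M
    right∈Max r (r∈X , after-r∉X) with M-overlaps-X
    ... | (z , z∈M , z∈X) , _ = Max-∈-mono-on-X z≤r (∈X⇒column∈X z∈X) r∈X
            (subst (_∈ M) (sym (inverseʳ π)) z∈M)
      where
      z≤r : π ⟨$⟩ˡ z ≤ᶠ r
      z≤r = ≮⇒≥ (λ r<z → after-r∉X _ r<z (∈X⇒column∈X z∈X))

lemma10 : ∀ {n m : ℕ} (F : Fin m → Subset n) → SortedLF F → Distinct F →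
    (π : Permutation′ n) → ColumnsSorted F π →
    (iX iY iM : Fin m) → IsMax F iX iM →
    Nonempty (F iX ∩ F iY) → ∣ F iX ∣ ≤ ∣ F iY ∣ → ∣ F iY ∣ ≤ ∣ F iM ∣ →
    (l r : Fin n) → IsLeft F π iX l → IsRight F π iX r →
    ((π ⟨$⟩ʳ l) ∉ F iY → Overlaps (F iY) (F iX)) ×
    ((π ⟨$⟩ʳ l) ∈ F iY →
      ((π ⟨$⟩ʳ r) ∉ F iY → Overlaps (F iY) (F iX)) ×
      ((π ⟨$⟩ʳ r) ∈ F iY → Overlaps (F iY) (F iM)))
lemma10 F sorted _ π columns-sorted iX iY iM isMax (w , w∈X∩Y) ∣X∣≤∣Y∣ ∣Y∣≤∣M∣ l r isLeft isRight =
  Y-overlaps-X (proj₁ isLeft) ,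
  λ l∈Y → Y-overlaps-X (proj₁ isRight) , λ r∈Y →
    Overlaps-sym (meets∧misses∧∣q∣≤∣p∣⇒Overlaps r∈M r∈Y l∈Y l∉M ∣Y∣≤∣M∣)
  where
  Y-overlaps-X : ∀ {x} → x ∈ F iX → x ∉ F iY → Overlaps (F iY) (F iX)
  Y-overlaps-X x∈X x∉Y =
    let (w∈X , w∈Y) = x∈p∩q⁻ (F iX) (F iY) w∈X∩Y
    in meets∧misses∧∣q∣≤∣p∣⇒Overlaps w∈Y w∈X x∈X x∉Y ∣X∣≤∣Y∣

  l∉M : π ⟨$⟩ʳ l ∉ F iM
  l∉M = left∉Max sorted isMax π columns-sorted l isLeft

  r∈M : π ⟨$⟩ʳ r ∈ F iM
  r∈M = right∈Max sorted isMax π columns-sorted r isRight
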